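{- Let $G=(V,E)$ be an unweighted graph with distinct vertex identifiers, $k\ge 2$, $r=k-1$, $p=1-n^{ -1/k}$, and let the clustering be constructed as follows: each vertex samples $\delta_v\sim\mathrm{GeomCap}(p,r)$, $d^{(u)}(s,x):=r-\delta_u+d_G(u,x)$, $d'(x):=\min_u d^{(u)}(s,x)$, and $c_x$ is the vertex $u$ of minimal $\mathrm{ID}$ with $d^{(u)}(s,x)=d'(x)$, with cluster $C_x=\{y:c_y=c_x\}$. Let $T$ be a forest consisting, for each cluster, of a tree of height at most $r$ rooted at its center spanning the cluster using edges of $G$ inside the cluster, and let $F\subseteq E$ be a set of edges such that for every $(u,v)\in E$ either $(u',v)\in F$ for some $u'\in C_u$ or $(u,v')\in F$ for some $v'\in C_v$. Then $H=(V,T\cup F)$ is a spanner of $G$ of stretch $2k-1$, i.e. $d_H(a,b)\le(2k-1)d_G(a,b)$ for all $a,b\in V$.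
   Context: $\mathrm{GeomCap}(p,r)$ is the distribution on $\{0,\dots,r\}$ with $\Pr[i]=p(1-p)^i$ for $0\le i\le r-1$ and $\Pr[r]=(1-p)^r$. -}

module Defs where

open import Data.Nat using (ℕ; zero; suc; _+_; _*_; _∸_; _≤_; _<_)
open import Data.Fin using (Fin)
open import Data.Product using (Σ; _×_)
open import Data.Sum using (_⊎_)
open import Relation.Nullary using (¬_)
open import Relation.Binary.PropositionalEquality using (_≡_; _≢_)
open import Function using (_∘_)

record Graph (n : ℕ) : Set₁ where
  field
    Adj    : Fin n → Fin n → Set
    sym    : ∀ {a b} → Adj a b → Adj b a
    irrefl : ∀ {a} → ¬ Adj a a
open Graph public

data Walk {n : ℕ} (E : Fin n → Fin n → Set) : Fin n → Fin n → ℕ → Set where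
  []  : ∀ {a} → Walk E a a 0
  _∷_ : ∀ {a b c L} → E a b → Walk E b c L → Walk E a c (suc L)

-- d_E(a,b) = d : there is a walk of length d and no shorter one.
-- (If there is no walk at all, d_E(a,b) = ∞ and no d satisfies Dist.)
Dist : {n : ℕ} → (Fin n → Fin n → Set) → Fin n → Fin n → ℕ → Set
Dist E a b d = Walk E a b d × (∀ {L} → Walk E a b L → d ≤ L)

DistLe : {n : ℕ} → (Fin n → Fin n → Set) → Fin n → Fin n → ℕ → Set
DistLe E a b m = Σ ℕ λ L → L ≤ m × Walk E a b L

-- The clustering.  r = k ∸ 1, δ u ∈ {0..r}, ID = vertex identifiers.
-- d^(u)(s,x) = r - δ u + d_G(u,x)   (∞ if x unreachable from u).
-- IsCenter G r δ ID x c  says: c = c_x, i.e. d^(c)(s,x) = d'(x) = min_u d^(u)(s,x),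
-- and c has the minimal ID among all u attaining this minimum.
IsCenter : {n : ℕ} → Graph n → ℕ → (Fin n → ℕ) → (Fin n → ℕ) → Fin n → Fin n → Set
IsCenter G r δ ID x c =
  Σ ℕ λ d → Dist (Adj G) c x d
    × (∀ u e → Dist (Adj G) u x e → r ∸ δ c + d ≤ r ∸ δ u + e)
    × (∀ u e → ID u < ID c → Dist (Adj G) u x e → r ∸ δ u + e ≢ r ∸ δ c + d)

iter : {A : Set} → (A → A) → ℕ → A → A
iter f zero    a = a
iter f (suc m) a = f (iter f m a)

-- The forest T, encoded by parent pointers: every non-center y has a parent
-- (a G-neighbour in the same cluster), the tree edges are {y, parent y} for
-- non-centers y, and every vertex reaches its center in at most r parent steps
-- (so each cluster's tree is rooted at its center and has height ≤ r).
IsClusterForest : {n : ℕ} → Graph n → ℕ → (c : Fin n → Fin n) → (parent : Fin n → Fin n) → Set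
IsClusterForest G r c parent =
  (∀ y → y ≢ c y → Adj G y (parent y) × c (parent y) ≡ c y)
  × (∀ y → Σ ℕ λ h → h ≤ r × iter parent h y ≡ c y)

TEdge : {n : ℕ} → (Fin n → Fin n) → (Fin n → Fin n) → Fin n → Fin n → Set
TEdge c parent a b = a ≢ c a × parent a ≡ b

HAdj : {n : ℕ} → (Fin n → Fin n) → (Fin n → Fin n) → (Fin n → Fin n → Set) → Fin n → Fin n → Set
HAdj c parent F a b = TEdge c parent a b ⊎ TEdge c parent b a ⊎ F a b ⊎ F b a

-- Every edge (u, v) of G is replaced in H by a path of length at most 2r + 1 = 2k − 1: climb the
-- tree of u's cluster to its center (≤ r steps), descend to the endpoint u′ of the covering
-- F-edge (≤ r steps), and cross (u′, v) (symmetrically if v's cluster carries the F-edge).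
-- Concatenating these paths along a shortest G-path gives the stretch bound. Only the tree-height
-- bound and the covering property of F enter; the particular clustering matters for the size of H.
module Submission where

open import Defs hiding (sym)
open import Data.Nat using (ℕ; zero; suc; _+_; _*_; _∸_; _≤_; z≤n)
open import Data.Nat.Properties using (+-mono-≤; ≤-trans; ≤-refl; +-comm; +-suc; +-identityʳ; *-suc)
open import Data.Fin using (Fin; toℕ; _≟_)
open import Data.Product using (Σ; _×_; _,_; proj₁; proj₂)
open import Data.Sum using (_⊎_; inj₁; inj₂)
open import Relation.Binary.PropositionalEquality using (_≡_; refl; sym; trans; cong; subst)
open import Relation.Nullary using (yes; no; contradiction)
open import Function.Definitions using (Injective)

module _ {n : ℕ} {E : Fin n → Fin n → Set} where

  _++ʷ_ : ∀ {a b c L M} → Walk E a b L → Walk E b c M → Walk E a c (L + M)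
  []      ++ʷ w = w
  (e ∷ v) ++ʷ w = e ∷ (v ++ʷ w)

  reverseʷ : (∀ {a b} → E a b → E b a) → ∀ {a b L} → Walk E a b L → Walk E b a L
  reverseʷ E-sym []                = []
  reverseʷ E-sym (_∷_ {L = L} e w) =
    subst (Walk E _ _) (+-comm L 1) (reverseʷ E-sym w ++ʷ (E-sym e ∷ []))

  DistLe-refl : ∀ {a b} → a ≡ b → DistLe E a b 0
  DistLe-refl refl = 0 , z≤n , []

  DistLe-edge : ∀ {a b} → E a b → DistLe E a b 1
  DistLe-edge e = 1 , ≤-refl , (e ∷ [])

  DistLe-trans : ∀ {a b c L M} → DistLe E a b L → DistLe E b c M → DistLe E a c (L + M)
  DistLe-trans (l , l≤L , v) (m , m≤M , w) = l + m , +-mono-≤ l≤L m≤M , v ++ʷ w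

  DistLe-sym : (∀ {a b} → E a b → E b a) → ∀ {a b L} → DistLe E a b L → DistLe E b a L
  DistLe-sym E-sym (l , l≤L , w) = l , l≤L , reverseʷ E-sym w

  DistLe-mono : ∀ {a b L M} → L ≤ M → DistLe E a b L → DistLe E a b M
  DistLe-mono L≤M (l , l≤L , w) = l , ≤-trans l≤L L≤M , w

walk-stretch : ∀ {n} {E H : Fin n → Fin n → Set} {s} → (∀ {a b} → E a b → DistLe H a b s)
             → ∀ {a b L} → Walk E a b L → DistLe H a b (s * L)
walk-stretch         stretch []                = DistLe-mono z≤n (DistLe-refl refl)
walk-stretch {s = s} stretch (_∷_ {L = L} e w) =
  subst (DistLe _ _ _) (sym (*-suc s L)) (DistLe-trans (stretch e) (walk-stretch stretch w))

iter-suc : ∀ {A : Set} (f : A → A) m a → iter f (suc m) a ≡ iter f m (f a)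
iter-suc f zero    a = refl
iter-suc f (suc m) a = cong f (iter-suc f m a)

2*suc∸1 : ∀ r → 2 * suc r ∸ 1 ≡ suc (r + r)
2*suc∸1 r = trans (+-suc r (r + 0)) (cong (λ m → suc (r + m)) (+-identityʳ r))

module ClusterSpanner {n : ℕ} (G : Graph n) (r : ℕ) (c parent : Fin n → Fin n)
                      (F : Fin n → Fin n → Set) (forest : IsClusterForest G r c parent) where

  H : Fin n → Fin n → Set
  H = HAdj c parent F

  H-sym : ∀ {a b} → H a b → H b a
  H-sym (inj₁ t)               = inj₂ (inj₁ t)
  H-sym (inj₂ (inj₁ t))        = inj₁ t
  H-sym (inj₂ (inj₂ (inj₁ f))) = inj₂ (inj₂ (inj₂ f))
  H-sym (inj₂ (inj₂ (inj₂ f))) = inj₂ (inj₂ (inj₁ f))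

  H-F : ∀ {a b} → F a b → H a b
  H-F f = inj₂ (inj₂ (inj₁ f))

  toCenter-within : ∀ h y → iter parent h y ≡ c y → DistLe H y (c y) h
  toCenter-within h y reaches with y ≟ c y
  ... | yes y≡cy = DistLe-mono z≤n (DistLe-refl y≡cy)
  toCenter-within zero    y reaches | no y≢cy = contradiction reaches y≢cy
  toCenter-within (suc h) y reaches | no y≢cy =
    DistLe-trans (DistLe-edge (inj₁ (y≢cy , refl)))
                 (subst (λ z → DistLe H (parent y) z h) same-center (toCenter-within h (parent y) parent-reaches))
    where
    same-center : c (parent y) ≡ c y
    same-center = proj₂ (proj₁ forest y y≢cy)

    parent-reaches : iter parent h (parent y) ≡ c (parent y)
    parent-reaches = trans (sym (iter-suc parent h y)) (trans reaches (sym same-center))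

  toCenter : ∀ y → DistLe H y (c y) r
  toCenter y with proj₂ forest y
  ... | h , h≤r , reaches = DistLe-mono h≤r (toCenter-within h y reaches)

  sameCluster : ∀ {x y} → c x ≡ c y → DistLe H x y (r + r)
  sameCluster {x} {y} cx≡cy =
    DistLe-trans (subst (λ z → DistLe H x z r) cx≡cy (toCenter x)) (DistLe-sym H-sym (toCenter y))

  edge-stretch : ∀ u v → (Σ (Fin n) λ u′ → c u′ ≡ c u × F u′ v) ⊎ (Σ (Fin n) λ v′ → c v′ ≡ c v × F u v′)
               → DistLe H u v (suc (r + r))
  edge-stretch u v (inj₁ (u′ , cu′≡cu , f)) =
    subst (DistLe H u v) (+-comm (r + r) 1) (DistLe-trans (sameCluster (sym cu′≡cu)) (DistLe-edge (H-F f)))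
  edge-stretch u v (inj₂ (v′ , cv′≡cv , f)) =
    DistLe-trans (DistLe-edge (H-F f)) (sameCluster cv′≡cv)

lemma10 : (n : ℕ) (G : Graph n) (ID : Fin n → ℕ) → Injective _≡_ _≡_ ID
    → (k : ℕ) → 2 ≤ k
    → (δ : Fin n → Fin k)
    → (c : Fin n → Fin n)
    → (∀ x → IsCenter G (k ∸ 1) (λ u → toℕ (δ u)) ID x (c x))
    → (parent : Fin n → Fin n) → IsClusterForest G (k ∸ 1) c parent
    → (F : Fin n → Fin n → Set)
    → (∀ a b → F a b → Adj G a b)
    → (∀ u v → Adj G u v
         → (Σ (Fin n) λ u′ → c u′ ≡ c u × F u′ v) ⊎ (Σ (Fin n) λ v′ → c v′ ≡ c v × F u v′))
    → ∀ a b d → Dist (Adj G) a b d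
    → DistLe (HAdj c parent F) a b ((2 * k ∸ 1) * d)
lemma10 _ G _ _ (suc r) _ _ c _ parent forest F _ covers a b d (shortest , _) =
  walk-stretch edge-bound shortest
  where
  open ClusterSpanner G r c parent F forest

  edge-bound : ∀ {u v} → Adj G u v → DistLe H u v (2 * suc r ∸ 1)
  edge-bound {u} {v} uv = subst (DistLe H u v) (sym (2*suc∸1 r)) (edge-stretch u v (covers u v uv))
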